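{- Let $n\geq 4$, let $f:\{0,1\}^n\to\{0,1\}^n$ be a Boolean network, and let $k$ be an integer with $8\leq k\leq 2^{n-1}$. Then $f$ has a $k$-nice set.
   Context: A Boolean network with $n$ components is a map $f:\{0,1\}^n\to\{0,1\}^n$. For $1\leq k\leq 2^{n-1}$, a $k$-nice set of $f$ is a set $A\subseteq\{0,1\}^n$ with $|A|=2k$ such that both $|f^{ -1}(A)|$ and $|f^{ -1}(A)\cap A|$ are even. -}

module Defs where

open import Data.Bool using (Bool; true; false; _∧_)
open import Data.Nat using (ℕ; zero; suc; _*_)
open import Data.Nat.Divisibility using (_∣_)
open import Data.Vec using (Vec; []; _∷_)
open import Data.List using (List; []; _∷_; _++_; map; length; filterᵇ)
open import Data.Product using (_×_)
open import Relation.Binary.PropositionalEquality using (_≡_)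

Point : ℕ → Set
Point n = Vec Bool n

BooleanNetwork : ℕ → Set
BooleanNetwork n = Point n → Point n

Subset : ℕ → Set
Subset n = Point n → Bool

allPoints : (n : ℕ) → List (Point n)
allPoints zero = [] ∷ []
allPoints (suc n) = map (true ∷_) (allPoints n) ++ map (false ∷_) (allPoints n)

card : {n : ℕ} → Subset n → ℕ
card {n} A = length (filterᵇ A (allPoints n))

preimage : {n : ℕ} → BooleanNetwork n → Subset n → Subset n
preimage f A x = A (f x)

_∩_ : {n : ℕ} → Subset n → Subset n → Subset n
(A ∩ B) x = A x ∧ B x

Even : ℕ → Set
Even m = 2 ∣ m

IsNice : {n : ℕ} → BooleanNetwork n → ℕ → Subset n → Set
IsNice f k A = (card A ≡ 2 * k) × Even (card (preimage f A)) × Even (card (preimage f A ∩ A))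

{-# OPTIONS --safe #-}

-- The whole cube is 2^(n-1)-nice, and we descend one k at a time. Removing two distinct points
-- u, v from a (j+1)-nice set A leaves a j-nice set as soon as u and v agree on the parities of
-- |f⁻¹(w)| and of [f w ∈ A] + |f⁻¹(w) ∩ A|, and f u ∈ {u, v} ⇔ f v ∈ {u, v} (then the arrows
-- of f inside {u, v} are even in number). The two parities sort A into four classes, so
-- |A| = 2j + 2 ≥ 17 puts five points into one class. Five points contain two fixed points, which
-- qualify, or four non-fixed ones; as each point sends out a single arrow, at most four of the
-- six pairs among those four carry a one-way arrow, and any other pair qualifies.

module Submission where

open import Defs
open import Algebra using (CommutativeRing)
open import Data.Bool using (Bool; true; false; not; _∧_; _xor_; T)
open import Data.Bool.Properties as Bool
  using (not-involutive; ¬-not; T-≡; ∧-zeroʳ; ∧-identityʳ; ∧-distribˡ-xor; ∧-distribʳ-xor; xor-identityʳ; xor-same;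
         xor-∧-commutativeRing)
open import Algebra.Properties.CommutativeSemigroup
  (CommutativeRing.+-commutativeSemigroup xor-∧-commutativeRing) using (interchange)
open import Data.List using (List; []; _∷_; [_]; _++_; map; length; filter; filterᵇ)
open import Data.List.Properties using (length-++; length-map; filter-all; filter-none; filter-≐)
open import Data.List.Membership.Propositional using (_∈_)
open import Data.List.Membership.Propositional.Properties using (∈-map⁺; ∈-map⁻; ∈-++⁺ˡ; ∈-++⁺ʳ)
open import Data.List.Relation.Binary.Disjoint.Propositional using (Disjoint)
open import Data.List.Relation.Unary.All as All using (All; []; _∷_)
open import Data.List.Relation.Unary.All.Properties using (all-filter) renaming (filter⁺ to All-filter⁺)
open import Data.List.Relation.Unary.AllPairs using ([]; _∷_)
open import Data.List.Relation.Unary.Any using (here; there)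
open import Data.List.Relation.Unary.Unique.Propositional using (Unique)
import Data.List.Relation.Unary.Unique.Propositional.Properties as Unique
open import Data.Nat using (ℕ; zero; suc; _+_; _*_; _^_; _≤_; _<_; _∸_; s≤s; _<?_)
open import Data.Nat.Divisibility using (divides)
open import Data.Nat.Properties
  using (+-suc; +-comm; +-identityʳ; *-suc; *-comm; +-cancelʳ-≡; +-cancelˡ-<; +-monoˡ-≤; *-monoʳ-≤;
         ≤-trans; <-≤-trans; ≮⇒≥; n≤1+n; m≤n⇒m<n∨m≡n)
open import Data.Product using (_×_; _,_; ∃; ∃₂)
open import Data.Sum using (_⊎_; inj₁; inj₂)
open import Data.Unit using (tt)
open import Data.Vec using ([]; _∷_)
open import Data.Vec.Properties using (≡-dec; ∷-injectiveʳ)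
open import Function using (_∘_; _⇔_; mk⇔; Equivalence)
open import Relation.Binary using (DecidableEquality)
open import Relation.Binary.PropositionalEquality
  using (_≡_; _≢_; refl; sym; trans; cong; cong₂; subst; _≗_; module ≡-Reasoning)
open import Relation.Nullary using (¬_; does; yes; no; contradiction)
open import Relation.Nullary.Decidable using (T?; dec-true; dec-false; does-⇔)
open import Relation.Unary using (Decidable)
open import Relation.Unary.Properties using (∁?)

open ≡-Reasoning

odd : ℕ → Bool
odd zero    = false
odd (suc m) = not (odd m)

odd-*2 : ∀ q → odd (q * 2) ≡ false
odd-*2 zero    = refl
odd-*2 (suc q) = trans (not-involutive (odd (q * 2))) (odd-*2 q)

¬odd⇒even : ∀ m → odd m ≡ false → Even m
¬odd⇒even zero          _    = divides 0 refl
¬odd⇒even (suc zero)    ()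
¬odd⇒even (suc (suc m)) ¬odd with ¬odd⇒even m (trans (sym (not-involutive (odd m))) ¬odd)
... | divides q m≡q*2 = divides (suc q) (cong (2 +_) m≡q*2)

even⇔¬odd : ∀ m → Even m ⇔ (odd m ≡ false)
even⇔¬odd m = mk⇔ (λ { (divides q refl) → odd-*2 q }) (¬odd⇒even m)

xor-balance : ∀ a b c d e → a xor c ≡ b xor d → (a xor b) xor ((c xor d) xor (e xor e)) ≡ false
xor-balance a b c d e a+c≡b+d = begin
  (a xor b) xor ((c xor d) xor (e xor e)) ≡⟨ cong (λ t → (a xor b) xor ((c xor d) xor t)) (xor-same e) ⟩
  (a xor b) xor ((c xor d) xor false)     ≡⟨ cong ((a xor b) xor_) (xor-identityʳ (c xor d)) ⟩
  (a xor b) xor (c xor d)                 ≡⟨ interchange a b c d ⟩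
  (a xor c) xor (b xor d)                 ≡⟨ cong (_xor (b xor d)) a+c≡b+d ⟩
  (b xor d) xor (b xor d)                 ≡⟨ xor-same (b xor d) ⟩
  false                                   ∎

module _ {X : Set} where

  parity : (X → Bool) → List X → Bool
  parity P []       = false
  parity P (x ∷ xs) = P x xor parity P xs

  infixl 6 _⊕_
  _⊕_ : (X → Bool) → (X → Bool) → X → Bool
  (P ⊕ Q) x = P x xor Q x

  parity-⊕ : ∀ (P Q : X → Bool) xs → parity (P ⊕ Q) xs ≡ parity P xs xor parity Q xs
  parity-⊕ P Q []       = refl
  parity-⊕ P Q (x ∷ xs) =
    trans (cong ((P x xor Q x) xor_) (parity-⊕ P Q xs)) (interchange (P x) (Q x) _ _)

  parity-≗ : ∀ {P Q : X → Bool} → P ≗ Q → ∀ xs → parity P xs ≡ parity Q xs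
  parity-≗ P≗Q []       = refl
  parity-≗ P≗Q (x ∷ xs) = cong₂ _xor_ (P≗Q x) (parity-≗ P≗Q xs)

  parity-∧ : ∀ (P Q : X → Bool) xs → parity (λ x → P x ∧ Q x) xs ≡ parity P (filterᵇ Q xs)
  parity-∧ P Q []       = refl
  parity-∧ P Q (x ∷ xs) with Q x
  ... | true  = cong₂ _xor_ (∧-identityʳ (P x)) (parity-∧ P Q xs)
  ... | false = trans (cong (_xor _) (∧-zeroʳ (P x))) (parity-∧ P Q xs)

  odd-length-filterᵇ : ∀ (P : X → Bool) xs → odd (length (filterᵇ P xs)) ≡ parity P xs
  odd-length-filterᵇ P []       = refl
  odd-length-filterᵇ P (x ∷ xs) with P x
  ... | true  = cong not (odd-length-filterᵇ P xs)
  ... | false = odd-length-filterᵇ P xs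

  length-filterᵇ-split : ∀ (P Q : X → Bool) xs →
    length (filterᵇ P xs) ≡ length (filterᵇ (λ x → P x ∧ not (Q x)) xs) + length (filterᵇ (λ x → P x ∧ Q x) xs)
  length-filterᵇ-split P Q []       = refl
  length-filterᵇ-split P Q (x ∷ xs) with P x | Q x
  ... | false | _     = length-filterᵇ-split P Q xs
  ... | true  | false = cong suc (length-filterᵇ-split P Q xs)
  ... | true  | true  = trans (cong suc (length-filterᵇ-split P Q xs)) (sym (+-suc _ _))

  filterᵇ-≗ : ∀ {P Q : X → Bool} → P ≗ Q → filterᵇ P ≗ filterᵇ Q
  filterᵇ-≗ {P} {Q} P≗Q =
    filter-≐ (T? ∘ P) (T? ∘ Q) ((λ {x} → subst T (P≗Q x)) , (λ {x} → subst T (sym (P≗Q x))))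

+-pigeonhole : ∀ {m n a b} → m + n < a + b → m < a ⊎ n < b
+-pigeonhole {m} {n} {a} {b} m+n<a+b with m <? a
... | yes m<a = inj₁ m<a
... | no  m≮a = inj₂ (+-cancelˡ-< m n b (<-≤-trans m+n<a+b (+-monoˡ-≤ b (≮⇒≥ m≮a))))

downward-induction : ∀ {ℓ} (P : ℕ → Set ℓ) {a b} → (∀ {j} → a ≤ j → P (suc j) → P j) → P b →
  ∀ {k} → a ≤ k → k ≤ b → P k
downward-induction P step Pb a≤k k≤b with m≤n⇒m<n∨m≡n k≤b
... | inj₂ refl        = Pb
... | inj₁ (s≤s k≤b-1) = downward-induction P step (step (≤-trans a≤k k≤b-1) Pb) a≤k k≤b-1

module _ {X : Set} where

  record MoreThan (m : ℕ) (Q : X → Set) : Set where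
    constructor pool
    field
      members  : List X
      satisfy  : All Q members
      distinct : Unique members
      many     : m < length members

  PairWith : (X → Set) → (X → X → Set) → Set
  PairWith Q R = ∃₂ λ u v → Q u × Q v × u ≢ v × R u v

  length-filter-∁ : ∀ {P : X → Set} (P? : Decidable P) xs →
    length (filter P? xs) + length (filter (∁? P?) xs) ≡ length xs
  length-filter-∁ P? []       = refl
  length-filter-∁ P? (x ∷ xs) with P? x
  ... | yes _ = cong suc (length-filter-∁ P? xs)
  ... | no  _ = trans (+-suc _ _) (cong suc (length-filter-∁ P? xs))

  MoreThan-split : ∀ {m n} {P Q : X → Set} → Decidable P → MoreThan (m + n) Q →
    MoreThan m (λ x → Q x × P x) ⊎ MoreThan n (λ x → Q x × ¬ P x)
  MoreThan-split P? (pool xs qs xs! m+n<)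
    with +-pigeonhole (subst (_ <_) (sym (length-filter-∁ P? xs)) m+n<)
  ... | inj₁ m< = inj₁ (pool (filter P? xs) (All.zip (All-filter⁺ P? qs , all-filter P? xs))
                             (Unique.filter⁺ P? xs!) m<)
  ... | inj₂ n< = inj₂ (pool (filter (∁? P?) xs) (All.zip (All-filter⁺ (∁? P?) qs , all-filter (∁? P?) xs))
                             (Unique.filter⁺ (∁? P?) xs!) n<)

  pigeonhole : ∀ {m} {Q : X → Set} (τ : X → Bool) → MoreThan (m + m) Q →
    ∃ λ b → MoreThan m (λ x → Q x × τ x ≡ b)
  pigeonhole τ S with MoreThan-split (λ x → τ x Bool.≟ true) S
  ... | inj₁ S-true              = true , S-true
  ... | inj₂ (pool xs qs xs! m<) = false , pool xs (All.map (λ (q , τx≢true) → q , ¬-not τx≢true) qs) xs! m<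

module Indicators {X : Set} (_≟_ : DecidableEquality X) where

  ｛_｝ : X → X → Bool
  ｛ u ｝ x = does (x ≟ u)

  -- xor rather than ∨ keeps parities additive; for u ≢ v it is the indicator of {u, v}.
  pair : X → X → X → Bool
  pair u v = ｛ u ｝ ⊕ ｛ v ｝

  filterᵇ-｛｝ : ∀ {u xs} → Unique xs → u ∈ xs → filterᵇ ｛ u ｝ xs ≡ [ u ]
  filterᵇ-｛｝ {u} {x ∷ xs} (x≢xs ∷ xs!) u∈ with x ≟ u | u∈
  ... | yes refl | _          =
    cong (x ∷_) (filter-none (T? ∘ ｛ x ｝) (All.map (λ x≢y → subst T (dec-false (_ ≟ x) (x≢y ∘ sym))) x≢xs))
  ... | no  x≢u  | here u≡x   = contradiction (sym u≡x) x≢u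
  ... | no  _    | there u∈xs = filterᵇ-｛｝ xs! u∈xs

  parity-∧-｛｝ : ∀ P {u xs} → Unique xs → u ∈ xs → parity (λ x → P x ∧ ｛ u ｝ x) xs ≡ P u
  parity-∧-｛｝ P {u} {xs} xs! u∈xs = begin
    parity (λ x → P x ∧ ｛ u ｝ x) xs ≡⟨ parity-∧ P ｛ u ｝ xs ⟩
    parity P (filterᵇ ｛ u ｝ xs)     ≡⟨ cong (parity P) (filterᵇ-｛｝ xs! u∈xs) ⟩
    P u xor false                     ≡⟨ xor-identityʳ (P u) ⟩
    P u                               ∎

  module _ (f : X → X) where

    Balanced : X → X → Set
    Balanced u v = pair u v (f u) ≡ pair u v (f v)

    Mutual : X → X → Set
    Mutual u v = f u ≡ v ⇔ f v ≡ u

    fixed-balanced : ∀ {u v} → f u ≡ u → f v ≡ v → u ≢ v → Balanced u v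
    fixed-balanced {u} {v} fu≡u fv≡v u≢v
      rewrite fu≡u | fv≡v | dec-true (u ≟ u) refl | dec-true (v ≟ v) refl
            | dec-false (u ≟ v) u≢v | dec-false (v ≟ u) (u≢v ∘ sym) = refl

    moving-balanced : ∀ {u v} → f u ≢ u → f v ≢ v → Mutual u v → Balanced u v
    moving-balanced {u} {v} fu≢u fv≢v u↔v
      rewrite dec-false (f u ≟ u) fu≢u | dec-false (f v ≟ v) fv≢v =
      trans (does-⇔ u↔v (f u ≟ v) (f v ≟ u)) (sym (xor-identityʳ _))

    mutual-or-arrow : ∀ x y → Mutual x y ⊎ (f x ≡ y ⊎ f y ≡ x)
    mutual-or-arrow x y with f x ≟ y | f y ≟ x
    ... | yes fx≡y | yes fy≡x = inj₁ (mk⇔ (λ _ → fy≡x) (λ _ → fx≡y))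
    ... | no  fx≢y | no  fy≢x =
      inj₁ (mk⇔ (λ fx≡y → contradiction fx≡y fx≢y) (λ fy≡x → contradiction fy≡x fy≢x))
    ... | yes fx≡y | no  _    = inj₂ (inj₁ fx≡y)
    ... | no  _    | yes fy≡x = inj₂ (inj₂ fy≡x)

    arrows-mutual : ∀ {x y z w} → f x ≡ y → f z ≡ w → y ≢ z → w ≢ x → Mutual x z
    arrows-mutual refl refl y≢z w≢x = mk⇔ (λ e → contradiction e y≢z) (λ e → contradiction e w≢x)

    mutual-pair : ∀ {Q} → MoreThan 3 Q → PairWith Q Mutual
    mutual-pair (pool [] _ _ ())
    mutual-pair (pool (_ ∷ []) _ _ (s≤s ()))
    mutual-pair (pool (_ ∷ _ ∷ []) _ _ (s≤s (s≤s ())))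
    mutual-pair (pool (_ ∷ _ ∷ _ ∷ []) _ _ (s≤s (s≤s (s≤s ()))))
    mutual-pair (pool (a ∷ b ∷ c ∷ d ∷ _) (qa ∷ qb ∷ qc ∷ qd ∷ _)
                      ((a≢b ∷ a≢c ∷ a≢d ∷ _) ∷ (b≢c ∷ b≢d ∷ _) ∷ (c≢d ∷ _) ∷ _) _)
      with mutual-or-arrow a b | mutual-or-arrow c d
    ... | inj₁ ab         | _               = a , b , qa , qb , a≢b , ab
    ... | inj₂ _          | inj₁ cd         = c , d , qc , qd , c≢d , cd
    ... | inj₂ (inj₁ a→b) | inj₂ (inj₁ c→d) = a , c , qa , qc , a≢c , arrows-mutual a→b c→d b≢c (a≢d ∘ sym)
    ... | inj₂ (inj₁ a→b) | inj₂ (inj₂ d→c) = a , d , qa , qd , a≢d , arrows-mutual a→b d→c b≢d (a≢c ∘ sym)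
    ... | inj₂ (inj₂ b→a) | inj₂ (inj₁ c→d) = b , c , qb , qc , b≢c , arrows-mutual b→a c→d a≢c (b≢d ∘ sym)
    ... | inj₂ (inj₂ b→a) | inj₂ (inj₂ d→c) = b , d , qb , qd , b≢d , arrows-mutual b→a d→c a≢d (b≢c ∘ sym)

    fixed-pair : ∀ {Q} → MoreThan 1 (λ x → Q x × f x ≡ x) → PairWith Q Balanced
    fixed-pair (pool [] _ _ ())
    fixed-pair (pool (_ ∷ []) _ _ (s≤s ()))
    fixed-pair (pool (a ∷ b ∷ _) ((qa , fa≡a) ∷ (qb , fb≡b) ∷ _) ((a≢b ∷ _) ∷ _) _) =
      a , b , qa , qb , a≢b , fixed-balanced fa≡a fb≡b a≢b

    balanced-pair : ∀ {Q} → MoreThan 4 Q → PairWith Q Balanced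
    balanced-pair S with MoreThan-split {m = 1} (λ x → f x ≟ x) S
    ... | inj₁ S-fixed  = fixed-pair S-fixed
    ... | inj₂ S-moving with mutual-pair S-moving
    ...   | u , v , (qu , fu≢u) , (qv , fv≢v) , u≢v , u↔v =
      u , v , qu , qv , u≢v , moving-balanced fu≢u fv≢v u↔v

    balanced-pair-agreeing : ∀ {Q} (τ σ : X → Bool) → MoreThan 16 Q →
      PairWith Q (λ u v → τ u ≡ τ v × σ u ≡ σ v × Balanced u v)
    balanced-pair-agreeing τ σ S with pigeonhole {m = 8} τ S
    ... | _ , S₁ with pigeonhole {m = 4} σ S₁
    ... | _ , S₂ with balanced-pair S₂
    ... | u , v , ((qu , τu) , σu) , ((qv , τv) , σv) , u≢v , balanced =
      u , v , qu , qv , u≢v , trans τu (sym τv) , trans σu (sym σv) , balanced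

allPoints-unique : ∀ n → Unique (allPoints n)
allPoints-unique zero    = [] ∷ []
allPoints-unique (suc n) =
  Unique.++⁺ (Unique.map⁺ ∷-injectiveʳ (allPoints-unique n)) (Unique.map⁺ ∷-injectiveʳ (allPoints-unique n))
             heads-differ
  where
  heads-differ : Disjoint (map (true ∷_) (allPoints n)) (map (false ∷_) (allPoints n))
  heads-differ (∈true , ∈false) with ∈-map⁻ (true ∷_) ∈true | ∈-map⁻ (false ∷_) ∈false
  ... | _ , _ , refl | _ , _ , ()

allPoints-complete : ∀ {n} (x : Point n) → x ∈ allPoints n
allPoints-complete []                  = here refl
allPoints-complete (true ∷ x)          = ∈-++⁺ˡ (∈-map⁺ (true ∷_) (allPoints-complete x))
allPoints-complete {suc n} (false ∷ x) =
  ∈-++⁺ʳ (map (true ∷_) (allPoints n)) (∈-map⁺ (false ∷_) (allPoints-complete x))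

length-allPoints : ∀ n → length (allPoints n) ≡ 2 ^ n
length-allPoints zero    = refl
length-allPoints (suc n) = begin
  length (map (true ∷_) ps ++ map (false ∷_) ps)         ≡⟨ length-++ (map (true ∷_) ps) ⟩
  length (map (true ∷_) ps) + length (map (false ∷_) ps) ≡⟨ cong₂ _+_ (length-map _ ps) (length-map _ ps) ⟩
  length ps + length ps                                  ≡⟨ cong (λ l → l + l) (length-allPoints n) ⟩
  2 ^ n + 2 ^ n                                          ≡⟨ cong (2 ^ n +_) (+-identityʳ (2 ^ n)) ⟨
  2 ^ suc n                                              ∎
  where ps = allPoints n

_≟_ : ∀ {n} → DecidableEquality (Point n)
_≟_ = ≡-dec Bool._≟_

module _ {n : ℕ} where

  open Indicators {Point n} _≟_ public

  oddCard : Subset n → Bool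
  oddCard A = parity A (allPoints n)

  even-card⇔ : (A : Subset n) → Even (card A) ⇔ (oddCard A ≡ false)
  even-card⇔ A =
    subst (λ b → Even (card A) ⇔ (b ≡ false)) (odd-length-filterᵇ A (allPoints n)) (even⇔¬odd (card A))

  card-full : card {n} (λ _ → true) ≡ 2 ^ n
  card-full =
    trans (cong length (filter-all (T? ∘ λ _ → true) (All.universal (λ _ → tt) (allPoints n)))) (length-allPoints n)

  card-≗ : ∀ {A B : Subset n} → A ≗ B → card A ≡ card B
  card-≗ A≗B = cong length (filterᵇ-≗ A≗B (allPoints n))

  card-｛｝ : ∀ u → card ｛ u ｝ ≡ 1
  card-｛｝ u = cong length (filterᵇ-｛｝ (allPoints-unique n) (allPoints-complete u))

  MoreThan-card : ∀ {m} {A : Subset n} → m < card A → MoreThan m (λ x → A x ≡ true)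
  MoreThan-card {A = A} m< =
    pool (filterᵇ A (allPoints n)) (All.map (Equivalence.to T-≡) (all-filter (T? ∘ A) (allPoints n)))
         (Unique.filter⁺ (T? ∘ A) (allPoints-unique n)) m<

  oddCard-⊕ : ∀ (A B : Subset n) → oddCard (A ⊕ B) ≡ oddCard A xor oddCard B
  oddCard-⊕ A B = parity-⊕ A B (allPoints n)

  oddCard-≗ : ∀ {A B : Subset n} → A ≗ B → oddCard A ≡ oddCard B
  oddCard-≗ A≗B = parity-≗ A≗B (allPoints n)

  oddCard-∩-｛｝ : ∀ (A : Subset n) u → oddCard (A ∩ ｛ u ｝) ≡ A u
  oddCard-∩-｛｝ A u = parity-∧-｛｝ A (allPoints-unique n) (allPoints-complete u)

  ∩-distribˡ-⊕ : ∀ (A B C : Subset n) → A ∩ (B ⊕ C) ≗ (A ∩ B) ⊕ (A ∩ C)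
  ∩-distribˡ-⊕ A B C x = ∧-distribˡ-xor (A x) (B x) (C x)

  ∩-distribʳ-⊕ : ∀ (A B C : Subset n) → (B ⊕ C) ∩ A ≗ (B ∩ A) ⊕ (C ∩ A)
  ∩-distribʳ-⊕ A B C x = ∧-distribʳ-xor (A x) (B x) (C x)

  oddCard-∩-pair : ∀ (A : Subset n) u v → oddCard (A ∩ pair u v) ≡ A u xor A v
  oddCard-∩-pair A u v =
    trans (oddCard-≗ (∩-distribˡ-⊕ A ｛ u ｝ ｛ v ｝))
          (trans (oddCard-⊕ _ _) (cong₂ _xor_ (oddCard-∩-｛｝ A u) (oddCard-∩-｛｝ A v)))

  oddCard-preimage-pair-∩ : ∀ (f : BooleanNetwork n) (A : Subset n) u v →
    oddCard (preimage f (pair u v) ∩ A) ≡ oddCard (preimage f ｛ u ｝ ∩ A) xor oddCard (preimage f ｛ v ｝ ∩ A)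
  oddCard-preimage-pair-∩ f A u v =
    trans (oddCard-≗ (∩-distribʳ-⊕ A (preimage f ｛ u ｝) (preimage f ｛ v ｝))) (oddCard-⊕ _ _)

  infixl 7 _∖_
  _∖_ : Subset n → Subset n → Subset n
  (A ∖ R) x = A x ∧ not (R x)

  infix 4 _⊆_
  _⊆_ : Subset n → Subset n → Set
  R ⊆ A = ∀ x → R x ≡ true → A x ≡ true

  ⊆⇒∖≗⊕ : ∀ {A R} → R ⊆ A → A ∖ R ≗ A ⊕ R
  ⊆⇒∖≗⊕ {A} {R} R⊆A x with R x in Rx
  ... | false = trans (∧-identityʳ (A x)) (sym (xor-identityʳ (A x)))
  ... | true rewrite R⊆A x Rx = refl

  ⊆⇒∩≗ : ∀ {A R} → R ⊆ A → A ∩ R ≗ R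
  ⊆⇒∩≗ {A} {R} R⊆A x with R x in Rx
  ... | false = ∧-zeroʳ (A x)
  ... | true rewrite R⊆A x Rx = refl

  card-∖ : ∀ {A R} → R ⊆ A → card A ≡ card (A ∖ R) + card R
  card-∖ {A} {R} R⊆A =
    trans (length-filterᵇ-split A R (allPoints n)) (cong (card (A ∖ R) +_) (card-≗ (⊆⇒∩≗ R⊆A)))

  oddCard-preimage-∖ : ∀ (f : BooleanNetwork n) {A R} → R ⊆ A →
    oddCard (preimage f (A ∖ R)) ≡ oddCard (preimage f A) xor oddCard (preimage f R)
  oddCard-preimage-∖ f R⊆A = trans (oddCard-≗ (⊆⇒∖≗⊕ R⊆A ∘ f)) (oddCard-⊕ _ _)

  oddCard-loops-∖ : ∀ (f : BooleanNetwork n) {A R} → R ⊆ A →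
    oddCard (preimage f (A ∖ R) ∩ (A ∖ R)) ≡
      (oddCard (preimage f A ∩ A) xor oddCard (preimage f A ∩ R)) xor
      (oddCard (preimage f R ∩ A) xor oddCard (preimage f R ∩ R))
  oddCard-loops-∖ f {A} {R} R⊆A = begin
      oddCard (preimage f (A ∖ R) ∩ (A ∖ R))
    ≡⟨ oddCard-≗ (λ x → cong₂ _∧_ (⊆⇒∖≗⊕ R⊆A (f x)) (⊆⇒∖≗⊕ R⊆A x)) ⟩
      oddCard ((fA ⊕ fR) ∩ (A ⊕ R))
    ≡⟨ oddCard-≗ (λ x → trans (∩-distribʳ-⊕ (A ⊕ R) fA fR x)
                              (cong₂ _xor_ (∩-distribˡ-⊕ fA A R x) (∩-distribˡ-⊕ fR A R x))) ⟩
      oddCard ((fA ∩ A) ⊕ (fA ∩ R) ⊕ ((fR ∩ A) ⊕ (fR ∩ R)))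
    ≡⟨ trans (oddCard-⊕ _ _) (cong₂ _xor_ (oddCard-⊕ _ _) (oddCard-⊕ _ _)) ⟩
      (oddCard (fA ∩ A) xor oddCard (fA ∩ R)) xor (oddCard (fR ∩ A) xor oddCard (fR ∩ R))
    ∎
    where
    fA = preimage f A
    fR = preimage f R

  pair⊆ : ∀ {A u v} → A u ≡ true → A v ≡ true → pair u v ⊆ A
  pair⊆ {u = u} {v} Au Av x x∈pair with x ≟ u | x ≟ v
  ... | yes refl | _        = Au
  ... | no _     | yes refl = Av
  ... | no _     | no _     = contradiction x∈pair λ ()

  card-pair : ∀ {u v} → u ≢ v → card (pair u v) ≡ 2
  card-pair {u} {v} u≢v = begin
    card (pair u v)                                 ≡⟨ length-filterᵇ-split (pair u v) ｛ u ｝ (allPoints n) ⟩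
    card (pair u v ∖ ｛ u ｝) + card (pair u v ∩ ｛ u ｝) ≡⟨ cong₂ _+_ (card-≗ pair∖u≗v) (card-≗ pair∩u≗u) ⟩
    card ｛ v ｝ + card ｛ u ｝                        ≡⟨ cong₂ _+_ (card-｛｝ v) (card-｛｝ u) ⟩
    2                                               ∎
    where
    pair∖u≗v : pair u v ∖ ｛ u ｝ ≗ ｛ v ｝
    pair∖u≗v x with x ≟ u
    ... | yes refl = trans (∧-zeroʳ _) (sym (dec-false (x ≟ v) u≢v))
    ... | no  _    = ∧-identityʳ _
    pair∩u≗u : pair u v ∩ ｛ u ｝ ≗ ｛ u ｝
    pair∩u≗u x with x ≟ u
    ... | yes refl rewrite dec-false (x ≟ v) u≢v = refl
    ... | no  _    = ∧-zeroʳ _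

module _ {n : ℕ} (f : BooleanNetwork n) where

  inDegreeParity : Point n → Bool
  inDegreeParity w = oddCard (preimage f ｛ w ｝)

  loopParity : Subset n → Point n → Bool
  loopParity A w = A (f w) xor oddCard (preimage f ｛ w ｝ ∩ A)

  ∖-pair-nice : ∀ {j A u v} → IsNice f (suc j) A → A u ≡ true → A v ≡ true → u ≢ v →
    inDegreeParity u ≡ inDegreeParity v → loopParity A u ≡ loopParity A v → Balanced f u v →
    IsNice f j (A ∖ pair u v)
  ∖-pair-nice {j} {A} {u} {v} (|A| , even-fA , even-fA∩A) Au Av u≢v same-degree same-loops balanced =
    card-A∖R , Equivalence.from (even-card⇔ (preimage f (A ∖ R))) preimage-even ,
    Equivalence.from (even-card⇔ (preimage f (A ∖ R) ∩ (A ∖ R))) loops-even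
    where
    R  = pair u v
    R⊆A = pair⊆ Au Av
    fA = preimage f A
    fR = preimage f R
    inA : Point n → Bool
    inA w = oddCard (preimage f ｛ w ｝ ∩ A)

    card-A∖R : card (A ∖ R) ≡ 2 * j
    card-A∖R = +-cancelʳ-≡ 2 (card (A ∖ R)) (2 * j) (begin
      card (A ∖ R) + 2        ≡⟨ cong (card (A ∖ R) +_) (card-pair u≢v) ⟨
      card (A ∖ R) + card R   ≡⟨ card-∖ R⊆A ⟨
      card A                  ≡⟨ |A| ⟩
      2 * suc j               ≡⟨ *-suc 2 j ⟩
      2 + 2 * j               ≡⟨ +-comm 2 (2 * j) ⟩
      2 * j + 2               ∎)

    preimage-even : oddCard (preimage f (A ∖ R)) ≡ false
    preimage-even = begin
      oddCard (preimage f (A ∖ R))          ≡⟨ oddCard-preimage-∖ f R⊆A ⟩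
      oddCard fA xor oddCard fR
        ≡⟨ cong₂ _xor_ (Equivalence.to (even-card⇔ fA) even-fA) (oddCard-⊕ (preimage f ｛ u ｝) (preimage f ｛ v ｝)) ⟩
      inDegreeParity u xor inDegreeParity v ≡⟨ cong (_xor inDegreeParity v) same-degree ⟩
      inDegreeParity v xor inDegreeParity v ≡⟨ xor-same (inDegreeParity v) ⟩
      false                                 ∎

    loops-even : oddCard (preimage f (A ∖ R) ∩ (A ∖ R)) ≡ false
    loops-even = begin
      oddCard (preimage f (A ∖ R) ∩ (A ∖ R))
        ≡⟨ oddCard-loops-∖ f R⊆A ⟩
      (oddCard (fA ∩ A) xor oddCard (fA ∩ R)) xor (oddCard (fR ∩ A) xor oddCard (fR ∩ R))
        ≡⟨ cong₂ _xor_ (cong₂ _xor_ (Equivalence.to (even-card⇔ (fA ∩ A)) even-fA∩A) (oddCard-∩-pair fA u v))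
                       (cong₂ _xor_ (oddCard-preimage-pair-∩ f A u v) (oddCard-∩-pair fR u v)) ⟩
      (fA u xor fA v) xor ((inA u xor inA v) xor (fR u xor fR v))
        ≡⟨ cong (λ b → (fA u xor fA v) xor ((inA u xor inA v) xor (fR u xor b))) (sym balanced) ⟩
      (fA u xor fA v) xor ((inA u xor inA v) xor (fR u xor fR u))
        ≡⟨ xor-balance (fA u) (fA v) (inA u) (inA v) (fR u) same-loops ⟩
      false
        ∎

  nice-descend : ∀ {j} → 8 ≤ j → ∃ (IsNice f (suc j)) → ∃ (IsNice f j)
  nice-descend 8≤j (A , nice@(|A| , _)) =
    let u , v , Au , Av , u≢v , same-degree , same-loops , balanced =
          balanced-pair-agreeing f inDegreeParity (loopParity A) (MoreThan-card 16<|A|)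
    in A ∖ pair u v , ∖-pair-nice nice Au Av u≢v same-degree same-loops balanced
    where
    16<|A| : 16 < card A
    16<|A| = subst (16 <_) (sym |A|) (≤-trans (n≤1+n 17) (*-monoʳ-≤ 2 (s≤s 8≤j)))

full-nice : ∀ {m} (f : BooleanNetwork (suc m)) → IsNice f (2 ^ m) (λ _ → true)
full-nice {m} f = card-full {suc m} , even , even
  where
  even : Even (card {suc m} (λ _ → true))
  even = divides (2 ^ m) (trans (card-full {suc m}) (*-comm 2 (2 ^ m)))

lemma5 : (n : ℕ) → 4 ≤ n → (f : BooleanNetwork n) → (k : ℕ) → 8 ≤ k → k ≤ 2 ^ (n ∸ 1) →
    ∃ λ (A : Subset n) → IsNice f k A
lemma5 (suc m) _ f k 8≤k k≤2^m =
  downward-induction (λ j → ∃ (IsNice f j)) (nice-descend f) (_ , full-nice f) 8≤k k≤2^m
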